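{- Let $P$ be a finite normal logic program, let $S\subseteq\mathrm{At}(P)$ be a strongly connected component of the positive dependency graph of $P$, and let $P_S=\bigcup_{a\in S}\mathrm{Def}(a,P)$ be the module of $P$ induced by $S$. Let $\mathrm{TOC}_S(P)$ be the tight ordered completion of $P$ relative to $S$ (defined in the context). 1. If $M\subseteq\mathrm{At}(P_S)$ is a stable model of $P_S$ for an input $I\subseteq\mathrm{At}(P_S)\setminus S$ and $\mathrm{lev}:M\cap S\to\mathbb{N}$ is the respective level ranking, then there is a DL-interpretation $\langle N,\tau\rangle$ satisfying $\mathrm{TOC}_S(P)$ with $\tau(z)=0$ such that $M=N\cap\mathrm{At}(P_S)$, $\tau(x_a)=\mathrm{lev}(a)$ for each $a\in M\cap S$, and $\tau(x_a)=|S|+1$ for each $a\in S\setminus M$. 2. If $\langle N,\tau\rangle$ is a DL-interpretation satisfying $\mathrm{TOC}_S(P)$, then $M=N\cap\mathrm{At}(P_S)$ is a stable model of $P_S$ for the input $I=N\cap(\mathrm{At}(P_S)\setminus S)$, and for each $a\in M\cap S$, $\mathrm{lev}(a)=\tau(x_a)-\tau(z)$ is the level rank of $a$ (with respect to $M$ and $I$).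
   Context: A normal logic program is a finite set of rules $r$ of the form $a\leftarrow b_1,\dots,b_n,\mathrm{not}\,c_1,\dots,\mathrm{not}\,c_m$ with propositional atoms; $\mathrm{head}(r)=a$, $B^+(r)=\{b_1,\dots,b_n\}$, $B^-(r)=\{c_1,\dots,c_m\}$. $\mathrm{At}(P)$ is the set of atoms occurring in $P$, and $\mathrm{Def}(a,P)=\{r\in P:\mathrm{head}(r)=a\}$. We write $a\to_P b$ if $b\in B^+(r)$ for some $r\in\mathrm{Def}(a,P)$; the positive dependency graph is $(\mathrm{At}(P),\to_P)$, and a strongly connected component (SCC) is a maximal set $S$ of atoms such that any two distinct atoms of $S$ are connected by directed paths in both directions. For an interpretation $M$ (a set of atoms), the reduct $P_S^M$ consists of $a\leftarrow B^+(r)$ for each $r\in P_S$ with $B^-(r)\cap M=\emptyset$. Atoms in $\mathrm{At}(P_S)\setminus S$ are input atoms. Given $I\subseteq\mathrm{At}(P_S)\setminus S$, define $T^0=I$ and $T^i=I\cup\{\mathrm{head}(r): r\in P_S^M,\ B^+(r)\subseteq T^{i-1}\}$ for $i\geq1$. $M\subseteq\mathrm{At}(P_S)$ is a stable model of $P_S$ for input $I$ iff $M\cap(\mathrm{At}(P_S)\setminus S)=I$ and $M=\bigcup_i T^i$ (the least model of $P_S^M\cup I$). The level ranking assigns to each $a\in M\cap S$ the least $i\geq1$ with $a\in T^i$. Difference logic (DL): formulas are propositional formulas over Boolean atoms whose atomic constituents may also be difference constraints $x-y\leq k$ over integer variables ($x>y$ abbreviates $y-x\leq-1$, etc.). A DL-interpretation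 $\langle N,\tau\rangle$ consists of a set $N$ of true Boolean atoms and an integer assignment $\tau$; $x-y\leq k$ holds iff $\tau(x)-\tau(y)\leq k$, and the connectives are evaluated classically. A special variable $z$ serves as reference point: constraints involving one variable are read relative to $z$ (e.g. $1\leq x_a$ means $z-x_a\leq-1$). $\mathrm{TOC}_S(P)$ uses integer variables $z$ and $x_a$ ($a\in S$), and new Boolean atoms $\mathrm{dep}_{a,b}$, $\mathrm{gap}_{a,b}$, $\mathrm{app}_r$, and consists of: (i) for each $a\in S$: $1\leq x_a-z\leq|S|+1$ and $\neg a\rightarrow(x_a-z\geq|S|+1)$; (ii) for all $a,b\in S$ with $a\to_P b$: $\mathrm{dep}_{a,b}\leftrightarrow b\wedge(x_a>x_b)$ and $\mathrm{gap}_{a,b}\leftrightarrow b\wedge(x_a>x_b+1)$; (iii) for each $a\in S$ with $\mathrm{Def}(a,P)=\{r_1,\dots,r_k\}$: $a\leftrightarrow \mathrm{app}_{r_1}\vee\dots\vee\mathrm{app}_{r_k}$; for each $i$: $\mathrm{app}_{r_i}\leftrightarrow\bigwedge_{b\in B^+(r_i)\cap S}\mathrm{dep}_{a,b}\wedge\bigwedge_{b\in B^+(r_i)\setminus S}b\wedge\bigwedge_{c\in B^-(r_i)}\neg c$; if $B^+(r_i)\cap S\neq\emptyset$: $\mathrm{app}_{r_i}\rightarrow\bigvee_{b\in B^+(r_i)\cap S}\neg\mathrm{gap}_{a,b}$; if $B^+(r_i)\cap S=\emptyset$: $\mathrm{app}_{r_i}\rightarrow(x_a-z\leq1)$. -}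

module Defs where

open import Data.Nat using (ℕ; zero; suc; _+_; _≤_; _<_; _≡ᵇ_)
import Data.Nat as ℕ
open import Data.Integer as ℤ using (ℤ; +_; -[1+_]; _-_)
import Data.Integer.Properties as ℤP
open import Data.Bool using (Bool; true; false; _∧_; _∨_; not; if_then_else_)
open import Data.List using (List; []; _∷_; _++_; filter; concatMap; map; length)
open import Data.Bool.ListAction using (any; all)
import Data.Bool
open import Data.List.Membership.Propositional using (_∈_; _∉_)
open import Data.List.Membership.DecPropositional ℕ._≟_ using (_∈?_)
open import Data.List.Relation.Binary.Subset.Propositional using (_⊆_)
open import Data.List.Relation.Unary.All using (All)
open import Data.Product using (Σ; ∃; _×_; _,_)
open import Relation.Nullary using (¬_; does; ¬?)
open import Relation.Binary.PropositionalEquality using (_≡_)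
open import Relation.Binary.Construct.Closure.ReflexiveTransitive using (Star)
open import Function.Bundles using (_⇔_)

record Rule : Set where
  constructor rule
  field
    head : ℕ
    pos  : List ℕ
    neg  : List ℕ
open Rule public

Program : Set
Program = List Rule

_∈ᵇ_ : ℕ → List ℕ → Bool
a ∈ᵇ xs = does (a ∈? xs)

At : Program → List ℕ
At P = concatMap (λ r → head r ∷ (pos r ++ neg r)) P

Def : ℕ → Program → Program
Def a P = filter (λ r → head r ℕ.≟ a) P

Edge : Program → ℕ → ℕ → Set
Edge P a b = Σ Rule λ r → r ∈ P × head r ≡ a × b ∈ pos r

edgeᵇ : Program → ℕ → ℕ → Bool
edgeᵇ P a b = any (λ r → (head r ≡ᵇ a) ∧ (b ∈ᵇ pos r)) P

Reach : Program → ℕ → ℕ → Set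
Reach P = Star (Edge P)

StronglyConnected : Program → List ℕ → Set
StronglyConnected P T = ∀ a b → a ∈ T → b ∈ T → ¬ (a ≡ b) → Reach P a b × Reach P b a

IsSCC : Program → List ℕ → Set
IsSCC P S = S ⊆ At P × StronglyConnected P S ×
  (∀ (T : List ℕ) → T ⊆ At P → S ⊆ T → StronglyConnected P T → T ⊆ S)

Module : Program → List ℕ → Program
Module P S = filter (λ r → head r ∈? S) P

Interp : Set
Interp = ℕ → Bool

-- the operator T^i for P_S^M ∪ I
T : Program → List ℕ → Interp → Interp → ℕ → ℕ → Bool
T P S M I zero    a = I a
T P S M I (suc i) a = I a ∨ any (λ r → (head r ≡ᵇ a) ∧ all (λ c → not (M c)) (neg r)
                                         ∧ all (T P S M I i) (pos r)) (Module P S)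

IsInput : Program → List ℕ → Interp → Set
IsInput P S I = ∀ a → I a ≡ true → a ∈ At (Module P S) × a ∉ S

IsStableModel : Program → List ℕ → Interp → Interp → Set
IsStableModel P S M I =
  (∀ a → M a ≡ true → a ∈ At (Module P S)) ×
  (∀ a → a ∈ At (Module P S) → a ∉ S → M a ≡ I a) ×
  (∀ a → (M a ≡ true) ⇔ (∃ λ i → T P S M I i a ≡ true))

IsLevelRank : Program → List ℕ → Interp → Interp → ℕ → ℕ → Set
IsLevelRank P S M I a n =
  1 ≤ n × T P S M I n a ≡ true × (∀ j → 1 ≤ j → j < n → T P S M I j a ≡ false)

data BAtom : Set where
  atm : ℕ → BAtom
  dep : ℕ → ℕ → BAtom
  gap : ℕ → ℕ → BAtom
  app : Rule → BAtom

data Var : Set where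
  z : Var
  x : ℕ → Var

infixr 4 _⇔'_ _⇒'_
infixr 5 _∨'_
infixr 6 _∧'_

data Form : Set where
  atom  : BAtom → Form
  diff  : Var → Var → ℤ → Form
  ⊤' ⊥' : Form
  ¬'_   : Form → Form
  _∧'_ _∨'_ _⇒'_ _⇔'_ : Form → Form → Form

record DLInterp : Set where
  constructor ⟨_,_⟩
  field
    N : BAtom → Bool
    τ : Var → ℤ
open DLInterp public

eval : DLInterp → Form → Bool
eval J (atom p)     = N J p
eval J (diff u v k) = does (τ J u - τ J v ℤ.≤? k)
eval J ⊤'           = true
eval J ⊥'           = false
eval J (¬' φ)       = not (eval J φ)
eval J (φ ∧' ψ)     = eval J φ ∧ eval J ψ
eval J (φ ∨' ψ)     = eval J φ ∨ eval J ψ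
eval J (φ ⇒' ψ)     = not (eval J φ) ∨ eval J ψ
eval J (φ ⇔' ψ)     = if eval J φ then eval J ψ else not (eval J ψ)

⋀ : List Form → Form
⋀ []       = ⊤'
⋀ (φ ∷ φs) = φ ∧' ⋀ φs

⋁ : List Form → Form
⋁ []       = ⊥'
⋁ (φ ∷ φs) = φ ∨' ⋁ φs

-- abbreviations
-- u ≥ v + k  is  v - u ≤ -k ;  u > v is v - u ≤ -1 ; u > v + 1 is v - u ≤ -2
geq : Var → Var → ℕ → Form
geq u v k = diff v u (ℤ.- (+ k))

leq : Var → Var → ℕ → Form
leq u v k = diff u v (+ k)

module _ (P : Program) (S : List ℕ) where

  private
    n : ℕ
    n = length S

    inS : ℕ → Bool
    inS b = b ∈ᵇ S

  TOC-i : ℕ → List Form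
  TOC-i a = (geq (x a) z 1 ∧' leq (x a) z (suc n))
          ∷ (¬' atom (atm a) ⇒' geq (x a) z (suc n))
          ∷ []

  TOC-ii : ℕ → ℕ → List Form
  TOC-ii a b = (atom (dep a b) ⇔' atom (atm b) ∧' geq (x a) (x b) 1)
             ∷ (atom (gap a b) ⇔' atom (atm b) ∧' geq (x a) (x b) 2)
             ∷ []

  TOC-rule : ℕ → Rule → List Form
  TOC-rule a r =
      (atom (app r) ⇔'
          ⋀ (map (λ b → atom (dep a b)) (filter (λ b → b ∈? S) (pos r)))
       ∧' ⋀ (map (λ b → atom (atm b)) (filter (λ b → ¬? (b ∈? S)) (pos r)))
       ∧' ⋀ (map (λ c → ¬' atom (atm c)) (neg r)))
    ∷ side (filter (λ b → b ∈? S) (pos r))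
    where
      side : List ℕ → List Form
      side []         = (atom (app r) ⇒' leq (x a) z 1) ∷ []
      side bs@(_ ∷ _) = (atom (app r) ⇒' ⋁ (map (λ b → ¬' atom (gap a b)) bs)) ∷ []

  TOC-iii : ℕ → List Form
  TOC-iii a = (atom (atm a) ⇔' ⋁ (map (λ r → atom (app r)) (Def a P)))
            ∷ concatMap (TOC-rule a) (Def a P)

  TOC : List Form
  TOC = concatMap TOC-i S
     ++ concatMap (λ a → concatMap (TOC-ii a) (filter (λ b → edgeᵇ P a b Data.Bool.≟ true) S)) S
     ++ concatMap TOC-iii S

_⊨TOC[_,_] : DLInterp → Program → List ℕ → Set
J ⊨TOC[ P , S ] = All (λ φ → eval J φ ≡ true) (TOC P S)

modelOf : Program → List ℕ → DLInterp → Interp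
modelOf P S J a = N J (atm a) ∧ (a ∈ᵇ At (Module P S))

inputOf : Program → List ℕ → DLInterp → Interp
inputOf P S J a = N J (atm a) ∧ (a ∈ᵇ At (Module P S)) ∧ not (a ∈ᵇ S)

-- Both directions read the difference constraints through the level v(a) = x_a − z of
-- a ∈ S, which lies in 1, …, |S|+1 and equals |S|+1 exactly for false atoms.  In a model of
-- TOC_S(P), tightness gives every true a ∈ S an applied rule with v(a) = 1 or an S-body atom
-- exactly one level lower; following these predecessors down visits distinct atoms of S, so
-- true atoms have level at most |S|.  Induction on v(a) then puts a into T^{v(a)}, and
-- induction on i shows that T^i contains only true atoms, those in S of level at most i.
-- Conversely, the level ranking of a stable model (|S|+1 outside M) satisfies TOC_S(P) when
-- dep, gap and app are read off their defining formulas: the same descending chain bounds the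
-- ranks by |S|, and tightness holds because a rule whose S-body lies two levels below its
-- head would derive the head one stage earlier.

module Submission where

open import Defs
open import Data.Nat using (ℕ; zero; suc; _+_; _≤_; _<_; z≤n; s≤s; _≡ᵇ_; _≤?_)
import Data.Nat.Properties as ℕP
open import Data.Integer as ℤ using (ℤ; +_; _-_; +≤+)
import Data.Integer.Properties as ℤP
open import Data.Integer.Tactic.RingSolver using (solve-∀)
open import Data.Bool using (Bool; true; false; _∧_; _∨_; not; if_then_else_)
import Data.Bool
open import Data.Bool.Properties using (T-≡; ¬-not; ∧-identityʳ)
open import Data.Bool.ListAction using (any; all)
open import Data.Fin using (Fin; toℕ)
open import Data.Fin.Properties using (toℕ-injective; toℕ≤pred[n]; injective⇒≤)
open import Data.List using (List; []; _∷_; _++_; filter; concatMap; map; length; lookup; drop)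
open import Data.List.Relation.Unary.All as All using (All; []; _∷_)
import Data.List.Relation.Unary.All.Properties as AllP
open import Data.List.Relation.Unary.Any as Any using (Any; here; there)
import Data.List.Relation.Unary.Any.Properties as AnyP
open import Data.List.Membership.Propositional using (_∈_; _∉_; find; lose)
open import Data.List.Membership.Propositional.Properties
  using (∈-filter⁻; ∈-filter⁺; ∈-concatMap⁺; ∈-++⁺ˡ; ∈-++⁺ʳ)
open import Data.List.Membership.DecPropositional ℕP._≟_ using (_∈?_)
open import Data.List.Relation.Unary.Unique.Propositional using (Unique)
open import Data.Product using (Σ; ∃; _×_; _,_; proj₁; proj₂)
open import Data.Sum using (_⊎_; inj₁; inj₂)
open import Data.Empty using (⊥-elim)
open import Function.Base using (id; _∘_; case_of_)
open import Function.Bundles using (_⇔_; mk⇔; Equivalence)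
open import Function.Construct.Composition using (_⇔-∘_)
open import Relation.Nullary using (Dec; does; yes; no; ¬?)
open import Relation.Nullary.Decidable using (dec-true; dec-false)
open import Relation.Binary.PropositionalEquality
  using (_≡_; refl; sym; trans; cong; cong₂; subst; subst₂)
open import Relation.Binary.Definitions using (tri<; tri≈; tri>)

private
  variable
    A : Set
    p q : Bool

∧-true⁻ : p ∧ q ≡ true → p ≡ true × q ≡ true
∧-true⁻ {true} {true} _ = refl , refl

∧-true⁺ : p ≡ true → q ≡ true → p ∧ q ≡ true
∧-true⁺ refl refl = refl

∨-true⁻ : p ∨ q ≡ true → p ≡ true ⊎ q ≡ true
∨-true⁻ {true}  _ = inj₁ refl
∨-true⁻ {false} h = inj₂ h

∨-trueˡ : p ≡ true → p ∨ q ≡ true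
∨-trueˡ refl = refl

∨-trueʳ : ∀ {p q} → q ≡ true → p ∨ q ≡ true
∨-trueʳ {p = true}  _ = refl
∨-trueʳ {p = false} h = h

not-true⁻ : not p ≡ true → p ≡ false
not-true⁻ {false} _ = refl

not-true⁺ : p ≡ false → not p ≡ true
not-true⁺ refl = refl

true≢false : p ≡ true → p ≡ false → A
true≢false refl ()

≡-true-ext : (p ≡ true → q ≡ true) → (q ≡ true → p ≡ true) → p ≡ q
≡-true-ext {true}          f _ = sym (f refl)
≡-true-ext {false} {true}  _ g = g refl
≡-true-ext {false} {false} _ _ = refl

does-true⁻ : {X : Set} (d : Dec X) → does d ≡ true → X
does-true⁻ (yes w) _ = w

any-true⁻ : (f : A → Bool) (xs : List A) → any f xs ≡ true → Any (λ y → f y ≡ true) xs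
any-true⁻ f xs h = Any.map (Equivalence.to T-≡) (AnyP.any⁻ f xs (Equivalence.from T-≡ h))

any-true⁺ : (f : A → Bool) {xs : List A} → Any (λ y → f y ≡ true) xs → any f xs ≡ true
any-true⁺ f h = Equivalence.to T-≡ (AnyP.any⁺ f (Any.map (Equivalence.from T-≡) h))

all-true⁻ : (f : A → Bool) (xs : List A) → all f xs ≡ true → All (λ y → f y ≡ true) xs
all-true⁻ f xs h = All.map (Equivalence.to T-≡) (AllP.all⁺ f xs (Equivalence.from T-≡ h))

all-true⁺ : (f : A → Bool) {xs : List A} → All (λ y → f y ≡ true) xs → all f xs ≡ true
all-true⁺ f h = Equivalence.to T-≡ (AllP.all⁻ f (All.map (Equivalence.from T-≡) h))

module _ {B : Set} {Q : B → Set} (f : A → List B) where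

  All-concatMap⁻ : ∀ {xs} → All Q (concatMap f xs) → ∀ {y} → y ∈ xs → All Q (f y)
  All-concatMap⁻ h = All.lookup (AllP.map⁻ (AllP.concat⁻ h))

  All-concatMap⁺ : ∀ {xs} → (∀ {y} → y ∈ xs → All Q (f y)) → All Q (concatMap f xs)
  All-concatMap⁺ h = AllP.concat⁺ (AllP.map⁺ (All.tabulate h))

module _ {Q R : A → Set} (R? : ∀ y → Dec (R y)) where

  All-filter⁻ : ∀ {xs} → All Q (filter R? xs) → ∀ {y} → y ∈ xs → R y → Q y
  All-filter⁻ h y∈xs ry = All.lookup h (∈-filter⁺ R? y∈xs ry)

  All-filter⁺ : ∀ {xs} → (∀ {y} → y ∈ xs → R y → Q y) → All Q (filter R? xs)
  All-filter⁺ h = All.tabulate λ y∈ → let (y∈xs , ry) = ∈-filter⁻ R? y∈ in h y∈xs ry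

  Any-filter⁻ : ∀ {xs} → Any Q (filter R? xs) → ∃ λ y → y ∈ xs × R y × Q y
  Any-filter⁻ h with find h
  ... | y , y∈ , qy = let (y∈xs , ry) = ∈-filter⁻ R? y∈ in y , y∈xs , ry , qy

Minimal : (ℕ → Bool) → ℕ → Set
Minimal f m = f m ≡ true × (∀ j → j < m → f j ≡ false)

Minimal-unique : ∀ {f m m′} → Minimal f m → Minimal f m′ → m ≡ m′
Minimal-unique {m = m} {m′} (fm , below) (fm′ , below′) with ℕP.<-cmp m m′
... | tri< m<m′ _ _ = true≢false fm (below′ m m<m′)
... | tri≈ _ m≡m′ _ = m≡m′
... | tri> _ _ m′<m = true≢false fm′ (below m′ m′<m)

-- the least i < k with f i, and k if there is none
least : (ℕ → Bool) → ℕ → ℕ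
least f zero    = zero
least f (suc k) = if f 0 then 0 else suc (least (λ i → f (suc i)) k)

least-≤ : ∀ (f : ℕ → Bool) k → least f k ≤ k
least-≤ f zero = z≤n
least-≤ f (suc k) with f 0
... | true  = z≤n
... | false = s≤s (least-≤ _ k)

least-below : ∀ (f : ℕ → Bool) k j → j < least f k → f j ≡ false
least-below f (suc k) j j< with f 0 in f0
least-below f (suc k) zero    _        | false = f0
least-below f (suc k) (suc j) (s≤s j<) | false = least-below (λ i → f (suc i)) k j j<

least-none : ∀ (f : ℕ → Bool) k → (∀ j → j < k → f j ≡ false) → least f k ≡ k
least-none f zero    _    = refl
least-none f (suc k) none rewrite none 0 (s≤s z≤n) =
  cong suc (least-none _ k (λ j j<k → none (suc j) (s≤s j<k)))

least-hit : ∀ (f : ℕ → Bool) k i → f i ≡ true → i ≤ k → f (least f k) ≡ true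
least-hit f zero    zero    fi _ = fi
least-hit f (suc k) i       fi i≤k with f 0 in f0
least-hit f (suc k) i       fi i≤k       | true  = f0
least-hit f (suc k) zero    fi _         | false = true≢false fi f0
least-hit f (suc k) (suc i) fi (s≤s i≤k) | false = least-hit (λ i → f (suc i)) k i fi i≤k

least-pos : ∀ (f : ℕ → Bool) k → f 0 ≡ false → 1 ≤ least f (suc k)
least-pos f k f0 rewrite f0 = s≤s z≤n

least-minimal : ∀ (f : ℕ → Bool) k i → f i ≡ true → i ≤ k → Minimal f (least f k)
least-minimal f k i fi i≤k = least-hit f k i fi i≤k , least-below f k

module LevelBound (S : List ℕ) (Level : ℕ → ℕ → Set)
  (Level-functional : ∀ {a m n} → Level a m → Level a n → m ≡ n)
  (Level-∈ : ∀ {a n} → Level a n → a ∈ S)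
  (Level-pred : ∀ {a k} → Level a (suc (suc k)) → ∃ λ b → Level b (suc k))
  where

  levels-below : ∀ {a k} → Level a (suc k) → ∀ j → j ≤ k → ∃ λ b → Level b (suc j)
  levels-below {a} {k} ℓa j j≤k with ℕP.m≤n⇒m<n∨m≡n j≤k
  ... | inj₂ refl = a , ℓa
  levels-below {k = suc k} ℓa j _ | inj₁ (s≤s j≤k) = levels-below (proj₂ (Level-pred ℓa)) j j≤k

  -- Distinct levels 1, …, n are carried by distinct atoms of S.
  Level-bound : ∀ {a n} → Level a n → n ≤ length S
  Level-bound {n = zero}  _  = z≤n
  Level-bound {n = suc k} ℓa = injective⇒≤ position-injective
    where
    atomAt : (i : Fin (suc k)) → ∃ λ b → Level b (suc (toℕ i))
    atomAt i = levels-below ℓa (toℕ i) (toℕ≤pred[n] i)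
    position : Fin (suc k) → Fin (length S)
    position i = Any.index (Level-∈ (proj₂ (atomAt i)))
    position-injective : ∀ {i j} → position i ≡ position j → i ≡ j
    position-injective {i} {j} eq = toℕ-injective (ℕP.suc-injective
      (Level-functional (proj₂ (atomAt i)) (subst (λ b → Level b _) (sym same-atom) (proj₂ (atomAt j)))))
      where
      same-atom : proj₁ (atomAt i) ≡ proj₁ (atomAt j)
      same-atom = trans (AnyP.lookup-index (Level-∈ (proj₂ (atomAt i))))
                   (trans (cong (lookup S) eq) (sym (AnyP.lookup-index (Level-∈ (proj₂ (atomAt j))))))

≡ᵇ-true⁻ : ∀ {m n} → (m ≡ᵇ n) ≡ true → m ≡ n
≡ᵇ-true⁻ {m} {n} h = ℕP.≡ᵇ⇒≡ m n (Equivalence.from T-≡ h)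

≡ᵇ-refl : ∀ n → (n ≡ᵇ n) ≡ true
≡ᵇ-refl n = Equivalence.to T-≡ (ℕP.≡⇒≡ᵇ n n refl)

∈ᵇ-true⁻ : ∀ {a xs} → (a ∈ᵇ xs) ≡ true → a ∈ xs
∈ᵇ-true⁻ {a} {xs} = does-true⁻ (a ∈? xs)

∈ᵇ-true⁺ : ∀ {a xs} → a ∈ xs → (a ∈ᵇ xs) ≡ true
∈ᵇ-true⁺ {a} {xs} = dec-true (a ∈? xs)

∈ᵇ-false⁺ : ∀ {a xs} → a ∉ xs → (a ∈ᵇ xs) ≡ false
∈ᵇ-false⁺ {a} {xs} = dec-false (a ∈? xs)

module _ (P : Program) where

  ∈-Def⁻ : ∀ {a r} → r ∈ Def a P → r ∈ P × head r ≡ a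
  ∈-Def⁻ {a} = ∈-filter⁻ (λ r → head r ℕP.≟ a)

  ∈-Def⁺ : ∀ {a r} → r ∈ P → head r ≡ a → r ∈ Def a P
  ∈-Def⁺ {a} = ∈-filter⁺ (λ r → head r ℕP.≟ a)

  Def-edge : ∀ {a b r} → r ∈ Def a P → b ∈ pos r → edgeᵇ P a b ≡ true
  Def-edge {a} {b} {r} r∈Def b∈pos with ∈-Def⁻ r∈Def
  ... | r∈P , refl = any-true⁺ (λ r → (head r ≡ᵇ a) ∧ (b ∈ᵇ pos r))
                       (lose r∈P (∧-true⁺ (≡ᵇ-refl a) (∈ᵇ-true⁺ b∈pos)))

module _ (P : Program) (S : List ℕ) where

  ∈-Module⁻ : ∀ {r} → r ∈ Module P S → r ∈ P × head r ∈ S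
  ∈-Module⁻ = ∈-filter⁻ (λ r → head r ∈? S)

  Def⊆Module : ∀ {a r} → a ∈ S → r ∈ Def a P → r ∈ Module P S
  Def⊆Module a∈S r∈Def with ∈-Def⁻ P r∈Def
  ... | r∈P , refl = ∈-filter⁺ (λ r → head r ∈? S) r∈P a∈S

  Module⊆Def : ∀ {r} → r ∈ Module P S → r ∈ Def (head r) P
  Module⊆Def r∈PS = ∈-Def⁺ P (proj₁ (∈-Module⁻ r∈PS)) refl

  private
    ∈-At : ∀ {r a} → r ∈ Module P S → a ∈ head r ∷ (pos r ++ neg r) → a ∈ At (Module P S)
    ∈-At r∈PS a∈r = ∈-concatMap⁺ (λ r → head r ∷ (pos r ++ neg r)) (lose r∈PS a∈r)

  head∈At : ∀ {r} → r ∈ Module P S → head r ∈ At (Module P S)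
  head∈At r∈PS = ∈-At r∈PS (here refl)

  pos∈At : ∀ {r b} → r ∈ Module P S → b ∈ pos r → b ∈ At (Module P S)
  pos∈At r∈PS b∈pos = ∈-At r∈PS (there (∈-++⁺ˡ b∈pos))

  neg∈At : ∀ {r c} → r ∈ Module P S → c ∈ neg r → c ∈ At (Module P S)
  neg∈At {r} r∈PS c∈neg = ∈-At r∈PS (there (∈-++⁺ʳ (pos r) c∈neg))

  module Consequence (M I : Interp) where

    Tᵢ : ℕ → ℕ → Bool
    Tᵢ = T P S M I

    Fires : ℕ → ℕ → Rule → Set
    Fires i a r = r ∈ Module P S × head r ≡ a × All (λ c → M c ≡ false) (neg r)
                × All (λ b → Tᵢ i b ≡ true) (pos r)

    private
      applies : ℕ → ℕ → Rule → Bool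
      applies i a r = (head r ≡ᵇ a) ∧ all (λ c → not (M c)) (neg r) ∧ all (Tᵢ i) (pos r)

    T-suc⁻ : ∀ i a → Tᵢ (suc i) a ≡ true → I a ≡ true ⊎ ∃ (Fires i a)
    T-suc⁻ i a h with ∨-true⁻ {I a} h
    ... | inj₁ Ia = inj₁ Ia
    ... | inj₂ some with find (any-true⁻ (applies i a) (Module P S) some)
    ... | r , r∈PS , r-applies with ∧-true⁻ {head r ≡ᵇ a} r-applies
    ... | head≡ , rest with ∧-true⁻ {all (λ c → not (M c)) (neg r)} rest
    ... | negs , poss = inj₂ (r , r∈PS , ≡ᵇ-true⁻ head≡
                             , All.map not-true⁻ (all-true⁻ (λ c → not (M c)) (neg r) negs)
                             , all-true⁻ (Tᵢ i) (pos r) poss)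

    T-suc⁺ : ∀ {i a r} → Fires i a r → Tᵢ (suc i) a ≡ true
    T-suc⁺ {i} {a} {r} (r∈PS , refl , negs , poss) =
      ∨-trueʳ {I a} (any-true⁺ (applies i a) (lose r∈PS
        (∧-true⁺ (≡ᵇ-refl (head r)) (∧-true⁺ (all-true⁺ (λ c → not (M c)) (All.map not-true⁺ negs))
                                              (all-true⁺ (Tᵢ i) poss)))))

    T-suc-mono : ∀ i a → Tᵢ i a ≡ true → Tᵢ (suc i) a ≡ true
    T-suc-mono zero    a h = ∨-trueˡ h
    T-suc-mono (suc i) a h with T-suc⁻ i a h
    ... | inj₁ Ia = ∨-trueˡ Ia
    ... | inj₂ (r , r∈PS , eq , negs , poss) =
      T-suc⁺ {suc i} (r∈PS , eq , negs , All.map (λ {b} → T-suc-mono i b) poss)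

    T-mono : ∀ {i j} a → i ≤ j → Tᵢ i a ≡ true → Tᵢ j a ≡ true
    T-mono {i} a i≤j h with ℕP.m≤n⇒m<n∨m≡n i≤j
    ... | inj₂ refl = h
    T-mono {j = suc j} a _ h | inj₁ (s≤s i≤j) = T-suc-mono j a (T-mono a i≤j h)

    T-∉S : ∀ i {a} → a ∉ S → Tᵢ i a ≡ I a
    T-∉S zero    _   = refl
    T-∉S (suc i) {a} a∉S = ≡-true-ext from-input ∨-trueˡ
      where
      from-input : Tᵢ (suc i) a ≡ true → I a ≡ true
      from-input h with T-suc⁻ i a h
      ... | inj₁ Ia = Ia
      ... | inj₂ (r , r∈PS , refl , _) = ⊥-elim (a∉S (proj₂ (∈-Module⁻ r∈PS)))

_⊨_ : DLInterp → Form → Set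
J ⊨ φ = eval J φ ≡ true

_⊨*_ : DLInterp → List Form → Set
J ⊨* φs = All (J ⊨_) φs

module _ {J : DLInterp} where

  ⊨⋀⁻ : ∀ {φs} → J ⊨ ⋀ φs → J ⊨* φs
  ⊨⋀⁻ {[]}     _ = []
  ⊨⋀⁻ {φ ∷ φs} h = let (hφ , hφs) = ∧-true⁻ {eval J φ} h in hφ ∷ ⊨⋀⁻ hφs

  ⊨⋀⁺ : ∀ {φs} → J ⊨* φs → J ⊨ ⋀ φs
  ⊨⋀⁺ []         = refl
  ⊨⋀⁺ (hφ ∷ hφs) = ∧-true⁺ hφ (⊨⋀⁺ hφs)

  ⋀-map-cong : ∀ {J′} (f : A → Form) xs → (∀ y → eval J (f y) ≡ eval J′ (f y)) →
               eval J (⋀ (map f xs)) ≡ eval J′ (⋀ (map f xs))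
  ⋀-map-cong f []       _  = refl
  ⋀-map-cong f (y ∷ xs) eq = cong₂ _∧_ (eq y) (⋀-map-cong f xs eq)

  ⊨⋁⁻ : ∀ {φs} → J ⊨ ⋁ φs → Any (J ⊨_) φs
  ⊨⋁⁻ {φ ∷ φs} h with ∨-true⁻ {eval J φ} h
  ... | inj₁ hφ  = here hφ
  ... | inj₂ hφs = there (⊨⋁⁻ hφs)

  ⊨⋁⁺ : ∀ {φs} → Any (J ⊨_) φs → J ⊨ ⋁ φs
  ⊨⋁⁺ (here hφ)   = ∨-trueˡ hφ
  ⊨⋁⁺ {φ ∷ _} (there hφs) = ∨-trueʳ {eval J φ} (⊨⋁⁺ hφs)

  ⊨⇔⁻ : ∀ {φ ψ} → J ⊨ (φ ⇔' ψ) → eval J φ ≡ eval J ψ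
  ⊨⇔⁻ {φ} {ψ} h with eval J φ | eval J ψ
  ... | true  | _ = sym h
  ... | false | _ = sym (not-true⁻ h)

  ⊨⇔⁺ : ∀ {φ ψ} → eval J φ ≡ eval J ψ → J ⊨ (φ ⇔' ψ)
  ⊨⇔⁺ {φ} {ψ} eq with eval J φ | eval J ψ
  ⊨⇔⁺ refl | true  | _ = refl
  ⊨⇔⁺ refl | false | _ = refl

  ⊨⇒⁻ : ∀ {φ ψ} → J ⊨ (φ ⇒' ψ) → J ⊨ φ → J ⊨ ψ
  ⊨⇒⁻ {φ} h hφ rewrite hφ = h

  ⊨⇒⁺ : ∀ {φ ψ} → (J ⊨ φ → J ⊨ ψ) → J ⊨ (φ ⇒' ψ)
  ⊨⇒⁺ {φ} f with eval J φ
  ... | true  = f refl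
  ... | false = refl

  ⊨diff : ∀ {u w k} → (J ⊨ diff u w k) ⇔ (τ J u - τ J w ℤ.≤ k)
  ⊨diff = mk⇔ (does-true⁻ (_ ℤ.≤? _)) (dec-true (_ ℤ.≤? _))

B-A≤-k⇔q+k≤p : ∀ {A B Z : ℤ} {p q} k → A - Z ≡ + p → B - Z ≡ + q →
             (B - A ℤ.≤ ℤ.- + k) ⇔ (q + k ≤ p)
B-A≤-k⇔q+k≤p {A} {B} {Z} {p} {q} k A-Z B-Z = mk⇔ to from
  where
  c : ℤ
  c = (A - Z) ℤ.+ + k
  shiftˡ : ∀ A B Z K → (B - A) ℤ.+ ((A - Z) ℤ.+ K) ≡ (B - Z) ℤ.+ K
  shiftˡ = solve-∀
  shiftʳ : ∀ A Z K → ℤ.- K ℤ.+ ((A - Z) ℤ.+ K) ≡ A - Z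
  shiftʳ = solve-∀
  unshift : ∀ X C → X ℤ.+ C - C ≡ X
  unshift = solve-∀
  lhs : (B - A) ℤ.+ c ≡ + (q + k)
  lhs = trans (shiftˡ A B Z (+ k)) (cong (ℤ._+ + k) B-Z)
  rhs : ℤ.- + k ℤ.+ c ≡ + p
  rhs = trans (shiftʳ A Z (+ k)) A-Z
  to : B - A ℤ.≤ ℤ.- + k → q + k ≤ p
  to h = ℤP.drop‿+≤+ (subst₂ ℤ._≤_ lhs rhs (ℤP.+-monoˡ-≤ c h))
  from : q + k ≤ p → B - A ℤ.≤ ℤ.- + k
  from h = subst₂ ℤ._≤_ (unshift (B - A) c) (unshift (ℤ.- + k) c)
             (ℤP.+-monoˡ-≤ (ℤ.- c) (subst₂ ℤ._≤_ (sym lhs) (sym rhs) (+≤+ h)))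

module LevelReading (J : DLInterp) (S : List ℕ) (v : ℕ → ℕ)
  (v-spec : ∀ {a} → a ∈ S → τ J (x a) - τ J z ≡ + v a) where

  ⊨geq-x : ∀ {a b} k → a ∈ S → b ∈ S → (J ⊨ geq (x a) (x b) k) ⇔ (v b + k ≤ v a)
  ⊨geq-x {a} {b} k a∈S b∈S =
    B-A≤-k⇔q+k≤p {τ J (x a)} {τ J (x b)} {τ J z} k (v-spec a∈S) (v-spec b∈S) ⇔-∘ ⊨diff {J}

  ⊨geq-z : ∀ {a} k → a ∈ S → (J ⊨ geq (x a) z k) ⇔ (k ≤ v a)
  ⊨geq-z {a} k a∈S =
    B-A≤-k⇔q+k≤p {τ J (x a)} {τ J z} {τ J z} k (v-spec a∈S) (ℤP.+-inverseʳ (τ J z)) ⇔-∘ ⊨diff {J}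

  ⊨leq-z : ∀ {a} k → a ∈ S → (J ⊨ leq (x a) z k) ⇔ (v a ≤ k)
  ⊨leq-z {a} k a∈S =
    mk⇔ (ℤP.drop‿+≤+ ∘ subst (ℤ._≤ + k) (v-spec a∈S)) (subst (ℤ._≤ + k) (sym (v-spec a∈S)) ∘ +≤+)
      ⇔-∘ ⊨diff {J}

  ⊨guarded⇔ : ∀ {a b} k β → a ∈ S → b ∈ S → J ⊨ (atom β ⇔' atom (atm b) ∧' geq (x a) (x b) k) →
              (N J β ≡ true) ⇔ (N J (atm b) ≡ true × v b + k ≤ v a)
  ⊨guarded⇔ {a} {b} k β a∈S b∈S h = mk⇔
    (λ β-true → let (b-true , h-geq) = ∧-true⁻ (trans (sym β≡) β-true)
                in b-true , Equivalence.to (⊨geq-x k a∈S b∈S) h-geq)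
    (λ (b-true , le) → trans β≡ (∧-true⁺ b-true (Equivalence.from (⊨geq-x k a∈S b∈S) le)))
    where
    β≡ : N J β ≡ eval J (atom (atm b) ∧' geq (x a) (x b) k)
    β≡ = ⊨⇔⁻ {J} {atom β} {atom (atm b) ∧' geq (x a) (x b) k} h

module RuleParts (S : List ℕ) where

  posS posN : Rule → List ℕ
  posS r = filter (λ b → b ∈? S) (pos r)
  posN r = filter (λ b → ¬? (b ∈? S)) (pos r)

  ∈-posS⁻ : ∀ {b r} → b ∈ posS r → b ∈ pos r × b ∈ S
  ∈-posS⁻ {r = r} = ∈-filter⁻ (λ b → b ∈? S) {xs = pos r}

  ∈-posS⁺ : ∀ {b r} → b ∈ pos r → b ∈ S → b ∈ posS r
  ∈-posS⁺ = ∈-filter⁺ (λ b → b ∈? S)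

  body : ℕ → Rule → Form
  body a r = ⋀ (map (λ b → atom (dep a b)) (posS r))
          ∧' ⋀ (map (λ b → atom (atm b)) (posN r))
          ∧' ⋀ (map (λ c → ¬' atom (atm c)) (neg r))

module Clauses (P : Program) (S : List ℕ) (J : DLInterp) where

  open RuleParts S

  private
    edgesFrom : ℕ → List ℕ
    edgesFrom a = filter (λ b → edgeᵇ P a b Data.Bool.≟ true) S

    clauses-ii : ℕ → List Form
    clauses-ii a = concatMap (TOC-ii P S a) (edgesFrom a)

  Sat-i Sat-ii Sat-iii : Set
  Sat-i   = ∀ {a} → a ∈ S → J ⊨* TOC-i P S a
  Sat-ii  = ∀ {a b} → a ∈ S → b ∈ S → edgeᵇ P a b ≡ true → J ⊨* TOC-ii P S a b
  Sat-iii = ∀ {a} → a ∈ S → J ⊨* TOC-iii P S a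

  ⊨TOC⁻ : J ⊨TOC[ P , S ] → Sat-i × Sat-ii × Sat-iii
  ⊨TOC⁻ h = All-concatMap⁻ (TOC-i P S) (AllP.++⁻ˡ _ h)
          , (λ {a} a∈S b∈S e → All-concatMap⁻ (TOC-ii P S a)
               (All-concatMap⁻ clauses-ii (AllP.++⁻ˡ _ h-ii-iii) a∈S)
               (∈-filter⁺ (λ b → edgeᵇ P a b Data.Bool.≟ true) b∈S e))
          , All-concatMap⁻ (TOC-iii P S) (AllP.++⁻ʳ (concatMap clauses-ii S) h-ii-iii)
    where
    h-ii-iii : J ⊨* (concatMap clauses-ii S ++ concatMap (TOC-iii P S) S)
    h-ii-iii = AllP.++⁻ʳ (concatMap (TOC-i P S) S) h

  ⊨TOC⁺ : Sat-i → Sat-ii → Sat-iii → J ⊨TOC[ P , S ]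
  ⊨TOC⁺ h-i h-ii h-iii = AllP.++⁺ (All-concatMap⁺ (TOC-i P S) h-i) (AllP.++⁺
    (All-concatMap⁺ clauses-ii λ {a} a∈S → All-concatMap⁺ (TOC-ii P S a) λ b∈edges →
      let (b∈S , e) = ∈-filter⁻ (λ b → edgeᵇ P a b Data.Bool.≟ true) b∈edges in h-ii a∈S b∈S e)
    (All-concatMap⁺ (TOC-iii P S) h-iii))

  BodyHolds : ℕ → Rule → Set
  BodyHolds a r = (∀ {b} → b ∈ pos r → b ∈ S → N J (dep a b) ≡ true)
                × (∀ {b} → b ∈ pos r → b ∉ S → N J (atm b) ≡ true)
                × All (λ c → N J (atm c) ≡ false) (neg r)

  ⊨body⁻ : ∀ {a r} → J ⊨ body a r → BodyHolds a r
  ⊨body⁻ {a} {r} h with ∧-true⁻ h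
  ... | h-deps , h-rest with ∧-true⁻ h-rest
  ... | h-posN , h-neg =
    All-filter⁻ (λ b → b ∈? S) (AllP.map⁻ (⊨⋀⁻ h-deps)) ,
    All-filter⁻ (λ b → ¬? (b ∈? S)) (AllP.map⁻ (⊨⋀⁻ h-posN)) ,
    All.map not-true⁻ (AllP.map⁻ (⊨⋀⁻ h-neg))

  ⊨body⁺ : ∀ {a r} → BodyHolds a r → J ⊨ body a r
  ⊨body⁺ {a} {r} (deps , posN-true , negs-false) =
    ∧-true⁺ (⊨⋀⁺ (AllP.map⁺ (All-filter⁺ (λ b → b ∈? S) deps)))
      (∧-true⁺ (⊨⋀⁺ (AllP.map⁺ (All-filter⁺ (λ b → ¬? (b ∈? S)) posN-true)))
               (⊨⋀⁺ (AllP.map⁺ (All.map not-true⁺ negs-false))))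

  Tight : ℕ → List ℕ → Set
  Tight a []           = J ⊨ leq (x a) z 1
  Tight a bs@(_ ∷ _)   = Any (λ b → N J (gap a b) ≡ false) bs

  private
    noGaps : ℕ → List ℕ → List Form
    noGaps a bs = map (λ b → ¬' atom (gap a b)) bs

  RuleClause : ℕ → Rule → Set
  RuleClause a r = N J (app r) ≡ eval J (body a r) × (N J (app r) ≡ true → Tight a (posS r))

  ⊨TOC-rule-tight : ∀ {a r} → J ⊨* TOC-rule P S a r → N J (app r) ≡ true → Tight a (posS r)
  ⊨TOC-rule-tight {a} {r} (_ ∷ h-side) app-r with posS r | h-side
  ... | []         | h ∷ [] = ⊨⇒⁻ {J} {atom (app r)} {leq (x a) z 1} h app-r
  ... | bs@(_ ∷ _) | h ∷ [] =
    Any.map not-true⁻ (AnyP.map⁻ (⊨⋁⁻ {J} {noGaps a bs}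
      (⊨⇒⁻ {J} {atom (app r)} {⋁ (noGaps a bs)} h app-r)))

  ⊨TOC-rule⁻ : ∀ {a r} → J ⊨* TOC-rule P S a r → RuleClause a r
  ⊨TOC-rule⁻ {a} {r} h@(h-app ∷ _) = ⊨⇔⁻ {J} {atom (app r)} {body a r} h-app , ⊨TOC-rule-tight h

  ⊨TOC-rule⁺ : ∀ {a r} → RuleClause a r → J ⊨* TOC-rule P S a r
  ⊨TOC-rule⁺ {a} {r} (app≡body , tight) = ⊨⇔⁺ {J} {atom (app r)} {body a r} app≡body ∷ side tight
    where
    -- drop 1 names the side condition, which TOC-rule builds with a local function
    side : (N J (app r) ≡ true → Tight a (posS r)) → J ⊨* drop 1 (TOC-rule P S a r)
    side t with posS r
    ... | []         = ⊨⇒⁺ {J} {atom (app r)} {leq (x a) z 1} t ∷ []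
    ... | bs@(_ ∷ _) =
      ⊨⇒⁺ {J} {atom (app r)} {⋁ (noGaps a bs)}
        (λ app-r → ⊨⋁⁺ (AnyP.map⁺ (Any.map not-true⁺ (t app-r)))) ∷ []

  Supported : ℕ → Set
  Supported a = (N J (atm a) ≡ true) ⇔ Any (λ r → N J (app r) ≡ true) (Def a P)

  private
    someApp : ℕ → Form
    someApp a = ⋁ (map (λ r → atom (app r)) (Def a P))

    ⊨someApp⇔ : ∀ {a} → (J ⊨ someApp a) ⇔ Any (λ r → N J (app r) ≡ true) (Def a P)
    ⊨someApp⇔ = mk⇔ (λ h → AnyP.map⁻ (⊨⋁⁻ {J} h)) (λ h → ⊨⋁⁺ {J} (AnyP.map⁺ h))

  ⊨TOC-iii⁻ : ∀ {a} → J ⊨* TOC-iii P S a → Supported a × (∀ {r} → r ∈ Def a P → RuleClause a r)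
  ⊨TOC-iii⁻ {a} (h-atm ∷ h-rules) =
    mk⇔ (λ atm-a → Equivalence.to ⊨someApp⇔ (trans (sym atm≡apps) atm-a))
        (λ apps → trans atm≡apps (Equivalence.from ⊨someApp⇔ apps)) ,
    λ r∈Def → ⊨TOC-rule⁻ (All-concatMap⁻ (TOC-rule P S a) h-rules r∈Def)
    where
    atm≡apps : N J (atm a) ≡ eval J (someApp a)
    atm≡apps = ⊨⇔⁻ {J} {atom (atm a)} {someApp a} h-atm

  ⊨TOC-iii⁺ : ∀ {a} → Supported a → (∀ {r} → r ∈ Def a P → RuleClause a r) → J ⊨* TOC-iii P S a
  ⊨TOC-iii⁺ {a} supp rules =
    ⊨⇔⁺ {J} {atom (atm a)} {someApp a}
      (≡-true-ext (Equivalence.from ⊨someApp⇔ ∘ Equivalence.to supp)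
                  (Equivalence.from supp ∘ Equivalence.to ⊨someApp⇔))
    ∷ All-concatMap⁺ (TOC-rule P S a) (λ r∈Def → ⊨TOC-rule⁺ (rules r∈Def))

module FromDL (P : Program) (S : List ℕ) (J : DLInterp) (J⊨TOC : J ⊨TOC[ P , S ]) where

  open RuleParts S
  open Clauses P S J

  M I : Interp
  M = modelOf P S J
  I = inputOf P S J

  open Consequence P S M I

  private
    n : ℕ
    n = length S

    sat-i : Sat-i
    sat-i = proj₁ (⊨TOC⁻ J⊨TOC)

    sat-ii : Sat-ii
    sat-ii = proj₁ (proj₂ (⊨TOC⁻ J⊨TOC))

    supported : ∀ {a} → a ∈ S → Supported a
    supported a∈S = proj₁ (⊨TOC-iii⁻ (proj₂ (proj₂ (⊨TOC⁻ J⊨TOC)) a∈S))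

    rule-clause : ∀ {a r} → a ∈ S → r ∈ Def a P → RuleClause a r
    rule-clause a∈S = proj₂ (⊨TOC-iii⁻ (proj₂ (proj₂ (⊨TOC⁻ J⊨TOC)) a∈S))

  lev : ℕ → ℕ
  lev a = ℤ.∣ τ J (x a) - τ J z ∣

  lev-spec : ∀ {a} → a ∈ S → τ J (x a) - τ J z ≡ + lev a
  lev-spec {a} a∈S with sat-i a∈S
  ... | h-range ∷ _ = sym (ℤP.0≤i⇒+∣i∣≡i (ℤP.≤-trans (+≤+ z≤n) (ℤP.neg-cancel-≤ below)))
    where
    swap : ∀ X Z → Z - X ≡ ℤ.- (X - Z)
    swap = solve-∀
    below : ℤ.- (τ J (x a) - τ J z) ℤ.≤ ℤ.- + 1
    below = subst (ℤ._≤ ℤ.- + 1) (swap (τ J (x a)) (τ J z))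
              (Equivalence.to (⊨diff {J}) (proj₁ (∧-true⁻ h-range)))

  open LevelReading J S lev lev-spec

  lev-range : ∀ {a} → a ∈ S → 1 ≤ lev a × lev a ≤ suc n
  lev-range a∈S with sat-i a∈S
  ... | h-range ∷ _ = let (h-lower , h-upper) = ∧-true⁻ h-range in
    Equivalence.to (⊨geq-z 1 a∈S) h-lower , Equivalence.to (⊨leq-z (suc n) a∈S) h-upper

  lev-false : ∀ {a} → a ∈ S → N J (atm a) ≡ false → suc n ≤ lev a
  lev-false {a} a∈S a-false with sat-i a∈S
  ... | _ ∷ h-false ∷ _ = Equivalence.to (⊨geq-z (suc n) a∈S)
                            (⊨⇒⁻ {J} {¬' atom (atm a)} {geq (x a) z (suc n)} h-false (not-true⁺ a-false))

  dep⇔ : ∀ {a b r} → a ∈ S → b ∈ S → r ∈ Def a P → b ∈ pos r →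
         (N J (dep a b) ≡ true) ⇔ (N J (atm b) ≡ true × lev b + 1 ≤ lev a)
  dep⇔ a∈S b∈S r∈Def b∈pos with sat-ii a∈S b∈S (Def-edge P r∈Def b∈pos)
  ... | h-dep ∷ _ = ⊨guarded⇔ 1 (dep _ _) a∈S b∈S h-dep

  gap⇔ : ∀ {a b r} → a ∈ S → b ∈ S → r ∈ Def a P → b ∈ pos r →
         (N J (gap a b) ≡ true) ⇔ (N J (atm b) ≡ true × lev b + 2 ≤ lev a)
  gap⇔ a∈S b∈S r∈Def b∈pos with sat-ii a∈S b∈S (Def-edge P r∈Def b∈pos)
  ... | _ ∷ h-gap ∷ _ = ⊨guarded⇔ 2 (gap _ _) a∈S b∈S h-gap

  Grounded : ℕ → Rule → Set
  Grounded a r = lev a ≤ 1 ⊎ ∃ λ b → b ∈ pos r × b ∈ S × N J (atm b) ≡ true × lev a ≡ suc (lev b)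

  tight⇒grounded : ∀ {a r} → a ∈ S → r ∈ Def a P → BodyHolds a r →
                   ∀ bs → (∀ {b} → b ∈ bs → b ∈ posS r) → Tight a bs → Grounded a r
  tight⇒grounded a∈S _ _ [] _ h = inj₁ (Equivalence.to (⊨leq-z 1 a∈S) h)
  tight⇒grounded {a} {r} a∈S r∈Def (deps , _ , _) bs@(_ ∷ _) bs⊆posS h with find h
  ... | b , b∈bs , gap-false with ∈-posS⁻ {r = r} (bs⊆posS b∈bs)
  ... | b∈pos , b∈S = inj₂ (b , b∈pos , b∈S , proj₁ dep-ab , ℕP.≤-antisym lev-a≤ lev-a≥)
    where
    dep-ab : N J (atm b) ≡ true × lev b + 1 ≤ lev a
    dep-ab = Equivalence.to (dep⇔ a∈S b∈S r∈Def b∈pos) (deps b∈pos b∈S)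
    lev-a≥ : suc (lev b) ≤ lev a
    lev-a≥ = subst (_≤ lev a) (ℕP.+-comm (lev b) 1) (proj₂ dep-ab)
    lev-a≤ : lev a ≤ suc (lev b)
    lev-a≤ = ℕP.≮⇒≥ λ lt → true≢false
      (Equivalence.from (gap⇔ a∈S b∈S r∈Def b∈pos)
        (proj₁ dep-ab , subst (_≤ lev a) (ℕP.+-comm 2 (lev b)) lt)) gap-false

  applied-rule : ∀ {a} → a ∈ S → N J (atm a) ≡ true →
                 ∃ λ r → r ∈ Def a P × BodyHolds a r × Grounded a r
  applied-rule {a} a∈S a-true with find (Equivalence.to (supported a∈S) a-true)
  ... | r , r∈Def , app-r =
    r , r∈Def , body-r , tight⇒grounded a∈S r∈Def body-r (posS r) id (proj₂ (rule-clause a∈S r∈Def) app-r)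
    where
    body-r : BodyHolds a r
    body-r = ⊨body⁻ {a} {r} (trans (sym (proj₁ (rule-clause a∈S r∈Def))) app-r)

  private
    TrueLevel : ℕ → ℕ → Set
    TrueLevel a k = a ∈ S × N J (atm a) ≡ true × lev a ≡ k

    TrueLevel-pred : ∀ {a k} → TrueLevel a (suc (suc k)) → ∃ λ b → TrueLevel b (suc k)
    TrueLevel-pred {a} {k} (a∈S , a-true , lev-eq) with applied-rule a∈S a-true
    ... | _ , _ , _ , inj₁ lev≤1 = ⊥-elim (ℕP.<⇒≱ (s≤s (s≤s z≤n)) (subst (_≤ 1) lev-eq lev≤1))
    ... | _ , _ , _ , inj₂ (b , _ , b∈S , b-true , lev-a≡) =
      b , b∈S , b-true , ℕP.suc-injective (trans (sym lev-a≡) lev-eq)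

  open LevelBound S TrueLevel (λ (_ , _ , e) (_ , _ , e′) → trans (sym e) e′) proj₁ TrueLevel-pred

  lev-bound : ∀ {a} → a ∈ S → N J (atm a) ≡ true → lev a ≤ n
  lev-bound a∈S a-true = Level-bound (a∈S , a-true , refl)

  M≡N : ∀ {b} → b ∈ At (Module P S) → M b ≡ N J (atm b)
  M≡N {b} b∈At rewrite ∈ᵇ-true⁺ b∈At = ∧-identityʳ (N J (atm b))

  I≡N : ∀ {b} → b ∈ At (Module P S) → b ∉ S → I b ≡ N J (atm b)
  I≡N {b} b∈At b∉S rewrite ∈ᵇ-true⁺ b∈At | ∈ᵇ-false⁺ b∉S = ∧-identityʳ (N J (atm b))

  input⁻ : ∀ {a} → I a ≡ true → N J (atm a) ≡ true × a ∈ At (Module P S) × a ∉ S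
  input⁻ {a} Ia with ∧-true⁻ {N J (atm a)} Ia
  ... | a-true , rest with ∧-true⁻ {a ∈ᵇ At (Module P S)} rest
  ... | a∈At , a∉S = a-true , ∈ᵇ-true⁻ a∈At , λ a∈S → true≢false (∈ᵇ-true⁺ a∈S) (not-true⁻ a∉S)

  input⇒model : ∀ {a} → I a ≡ true → M a ≡ true
  input⇒model Ia = let (a-true , a∈At , _) = input⁻ Ia in trans (M≡N a∈At) a-true

  N-false⇒M-false : ∀ {a} → N J (atm a) ≡ false → M a ≡ false
  N-false⇒M-false a-false rewrite a-false = refl

  derivable : ∀ k {a} → a ∈ S → N J (atm a) ≡ true → lev a ≤ k → Tᵢ (lev a) a ≡ true
  derivable zero a∈S _ lev≤0 = ⊥-elim (ℕP.<⇒≱ (proj₁ (lev-range a∈S)) lev≤0)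
  derivable (suc k) {a} a∈S a-true lev≤k with applied-rule a∈S a-true | lev a in lev-eq
  ... | _ | zero = ⊥-elim (ℕP.<⇒≱ (subst (1 ≤_) lev-eq (proj₁ (lev-range a∈S))) z≤n)
  ... | r , r∈Def , (deps , posN-true , negs-false) , _ | suc j =
    T-suc⁺ {j} (Def⊆Module P S a∈S r∈Def , proj₂ (∈-Def⁻ P r∈Def) ,
            All.map N-false⇒M-false negs-false , All.tabulate body-derived)
    where
    j≤k : j ≤ k
    j≤k = ℕP.≤-pred lev≤k
    body-derived : ∀ {b} → b ∈ pos r → Tᵢ j b ≡ true
    body-derived {b} b∈pos with b ∈? S
    ... | no b∉S = trans (T-∉S j b∉S) (trans (I≡N (pos∈At P S (Def⊆Module P S a∈S r∈Def) b∈pos) b∉S)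
                                               (posN-true b∈pos b∉S))
    ... | yes b∈S = T-mono b lev-b≤j (derivable k b∈S b-true (ℕP.≤-trans lev-b≤j j≤k))
      where
      dep-ab : N J (atm b) ≡ true × lev b + 1 ≤ lev a
      dep-ab = Equivalence.to (dep⇔ a∈S b∈S r∈Def b∈pos) (deps b∈pos b∈S)
      b-true : N J (atm b) ≡ true
      b-true = proj₁ dep-ab
      lev-b≤j : lev b ≤ j
      lev-b≤j = ℕP.≤-pred (subst₂ _≤_ (ℕP.+-comm (lev b) 1) lev-eq (proj₂ dep-ab))

  private
    module _ {i r} (fires : Fires i (head r) r)
             (ih : ∀ {b} → b ∈ pos r → M b ≡ true × (b ∈ S → lev b ≤ i)) where

      r∈PS : r ∈ Module P S
      r∈PS = proj₁ fires

      a∈S : head r ∈ S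
      a∈S = proj₂ (∈-Module⁻ P S r∈PS)

      r∈Def : r ∈ Def (head r) P
      r∈Def = Module⊆Def P S r∈PS

      body-true : ∀ {b} → b ∈ pos r → N J (atm b) ≡ true
      body-true b∈pos = trans (sym (M≡N (pos∈At P S r∈PS b∈pos))) (proj₁ (ih b∈pos))

      -- the S-body lies below the head: r is applied, and tightness bounds lev
      fired-below : All (λ b → suc (lev b) ≤ lev (head r)) (posS r) →
                    N J (atm (head r)) ≡ true × lev (head r) ≤ suc i
      fired-below below = Equivalence.from (supported a∈S) (lose r∈Def app-r) ,
                          bound (tight⇒grounded a∈S r∈Def body-r (posS r) id (proj₂ clause app-r))
        where
        a : ℕ
        a = head r
        clause : RuleClause a r
        clause = rule-clause a∈S r∈Def
        body-r : BodyHolds a r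
        body-r = (λ {b} b∈pos b∈S → Equivalence.from (dep⇔ a∈S b∈S r∈Def b∈pos)
                   (body-true b∈pos , subst (_≤ lev a) (ℕP.+-comm 1 (lev b))
                                        (All.lookup below (∈-posS⁺ {r = r} b∈pos b∈S))))
               , (λ b∈pos _ → body-true b∈pos)
               , All.tabulate (λ c∈neg → trans (sym (M≡N (neg∈At P S r∈PS c∈neg)))
                                              (All.lookup (proj₁ (proj₂ (proj₂ fires))) c∈neg))
        app-r : N J (app r) ≡ true
        app-r = trans (proj₁ clause) (⊨body⁺ {a} {r} body-r)
        bound : Grounded a r → lev a ≤ suc i
        bound (inj₁ lev≤1) = ℕP.≤-trans lev≤1 (s≤s z≤n)
        bound (inj₂ (b , b∈pos , b∈S , _ , lev-a≡)) =
          subst (_≤ suc i) (sym lev-a≡) (s≤s (proj₂ (ih b∈pos) b∈S))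

      -- the head cannot be false, as false atoms lie above every true one
      fired-above : ∀ {b} → b ∈ pos r → b ∈ S → lev (head r) ≤ lev b →
                    N J (atm (head r)) ≡ true × lev (head r) ≤ suc i
      fired-above {b} b∈pos b∈S lev-a≤lev-b = head-true , ℕP.m≤n⇒m≤1+n lev-a≤i
        where
        lev-a≤i : lev (head r) ≤ i
        lev-a≤i = ℕP.≤-trans lev-a≤lev-b (proj₂ (ih b∈pos) b∈S)
        head-true : N J (atm (head r)) ≡ true
        head-true with N J (atm (head r)) in a-eq
        ... | true  = refl
        ... | false = ⊥-elim (ℕP.<⇒≱ (ℕP.≤-trans (lev-false a∈S a-eq) lev-a≤lev-b)
                                      (lev-bound b∈S (body-true b∈pos)))

      fired : N J (atm (head r)) ≡ true × lev (head r) ≤ suc i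
      fired with All.all? (λ b → suc (lev b) ≤? lev (head r)) (posS r)
      ... | yes below = fired-below below
      ... | no not-below
        with Any-filter⁻ (λ b → b ∈? S)
               (AllP.¬All⇒Any¬ (λ b → suc (lev b) ≤? lev (head r)) (posS r) not-below)
      ... | b , b∈pos , b∈S , not-lt = fired-above b∈pos b∈S (ℕP.≮⇒≥ not-lt)

  sound : ∀ i {a} → Tᵢ i a ≡ true → M a ≡ true × (a ∈ S → lev a ≤ i)
  sound zero h = input⇒model h , λ a∈S → ⊥-elim (proj₂ (proj₂ (input⁻ h)) a∈S)
  sound (suc i) {a} h with T-suc⁻ i a h
  ... | inj₁ Ia = input⇒model Ia , λ a∈S → ⊥-elim (proj₂ (proj₂ (input⁻ Ia)) a∈S)
  ... | inj₂ (r , fires@(r∈PS , refl , _ , poss)) =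
    trans (M≡N (head∈At P S r∈PS)) (proj₁ head-fired) , λ _ → proj₂ head-fired
    where
    head-fired : N J (atm a) ≡ true × lev a ≤ suc i
    head-fired = fired fires (λ b∈pos → sound i (All.lookup poss b∈pos))

  isInput : IsInput P S I
  isInput a Ia = proj₂ (input⁻ Ia)

  complete : ∀ a → M a ≡ true → ∃ λ i → Tᵢ i a ≡ true
  complete a Ma with a ∈? S
  ... | yes a∈S = lev a , derivable (lev a) a∈S (proj₁ (∧-true⁻ Ma)) ℕP.≤-refl
  ... | no a∉S  = 0 , trans (I≡N a∈At a∉S) (proj₁ (∧-true⁻ Ma))
    where
    a∈At : a ∈ At (Module P S)
    a∈At = ∈ᵇ-true⁻ (proj₂ (∧-true⁻ {N J (atm a)} Ma))

  isStable : IsStableModel P S M I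
  isStable = (λ a Ma → ∈ᵇ-true⁻ (proj₂ (∧-true⁻ {N J (atm a)} Ma)))
           , (λ a a∈At a∉S → trans (M≡N a∈At) (sym (I≡N a∈At a∉S)))
           , (λ a → mk⇔ (complete a) (λ (i , h) → proj₁ (sound i h)))

  isLevelRank : ∀ {a} → a ∈ S → M a ≡ true → IsLevelRank P S M I a (lev a)
  isLevelRank {a} a∈S Ma =
    proj₁ (lev-range a∈S) , derivable (lev a) a∈S (proj₁ (∧-true⁻ Ma)) ℕP.≤-refl , λ j _ → not-derived j
    where
    not-derived : ∀ j → j < lev a → Tᵢ j a ≡ false
    not-derived j j<lev with Tᵢ j a in h
    ... | false = refl
    ... | true  = ⊥-elim (ℕP.<⇒≱ j<lev (proj₂ (sound j h) a∈S))

module ToDL (P : Program) (S : List ℕ) (M I : Interp)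
            (input : IsInput P S I) (stable : IsStableModel P S M I) where

  open Consequence P S M I
  open RuleParts S

  private
    n : ℕ
    n = length S

  T⇒M : ∀ {i a} → Tᵢ i a ≡ true → M a ≡ true
  T⇒M {i} {a} h = Equivalence.from (proj₂ (proj₂ stable) a) (i , h)

  I-false : ∀ {a} → a ∈ S → I a ≡ false
  I-false {a} a∈S with I a in Ia
  ... | false = refl
  ... | true  = ⊥-elim (proj₂ (input a Ia) a∈S)

  private
    LeastDerived : ℕ → ℕ → Set
    LeastDerived a m = a ∈ S × Minimal (λ i → Tᵢ i a) m

    -- a rule deriving a at stage k+2 but not earlier has a body atom in S first derived at stage k+1
    LeastDerived-pred : ∀ {a k} → LeastDerived a (suc (suc k)) → ∃ λ b → LeastDerived b (suc k)
    LeastDerived-pred {a} {k} (a∈S , derived , underived) with T-suc⁻ (suc k) a derived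
    ... | inj₁ Ia = true≢false Ia (I-false a∈S)
    ... | inj₂ (r , r∈PS , head≡ , negs , poss) with All.all? (λ b → Tᵢ k b Data.Bool.≟ true) (pos r)
    ... | yes all-k = true≢false (T-suc⁺ {k} (r∈PS , head≡ , negs , all-k)) (underived (suc k) ℕP.≤-refl)
    ... | no not-all with find (AllP.¬All⇒Any¬ (λ b → Tᵢ k b Data.Bool.≟ true) (pos r) not-all)
    ... | b , b∈pos , not-k with b ∈? S
    ... | no b∉S =
      ⊥-elim (not-k (trans (T-∉S k b∉S) (trans (sym (T-∉S (suc k) b∉S)) (All.lookup poss b∈pos))))
    ... | yes b∈S = b , b∈S , All.lookup poss b∈pos , underived-b
      where
      underived-b : ∀ j → j < suc k → Tᵢ j b ≡ false
      underived-b j j<k+1 with Tᵢ j b in h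
      ... | false = refl
      ... | true  = ⊥-elim (not-k (T-mono b (ℕP.≤-pred j<k+1) h))

  open LevelBound S LeastDerived (λ (_ , m) (_ , m′) → Minimal-unique m m′) proj₁ LeastDerived-pred

  -- the level ranking, extended by |S| + 1 to the atoms of S outside M
  lvl : ℕ → ℕ
  lvl a = least (λ i → Tᵢ i a) (suc n)

  lvl-minimal : ∀ {a} → a ∈ S → M a ≡ true → Minimal (λ i → Tᵢ i a) (lvl a) × lvl a ≤ n
  lvl-minimal {a} a∈S Ma = subst (Minimal f) (sym lvl≡m) m-minimal , subst (_≤ n) (sym lvl≡m) m≤n
    where
    f : ℕ → Bool
    f i = Tᵢ i a
    witness : ∃ λ i → f i ≡ true
    witness = Equivalence.to (proj₂ (proj₂ stable) a) Ma
    m : ℕ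
    m = least f (proj₁ witness)
    m-minimal : Minimal f m
    m-minimal = least-minimal f (proj₁ witness) (proj₁ witness) (proj₂ witness) ℕP.≤-refl
    m≤n : m ≤ n
    m≤n = Level-bound (a∈S , m-minimal)
    lvl≡m : lvl a ≡ m
    lvl≡m = Minimal-unique (least-minimal f (suc n) m (proj₁ m-minimal) (ℕP.m≤n⇒m≤1+n m≤n)) m-minimal

  lvl-false : ∀ {a} → M a ≡ false → lvl a ≡ suc n
  lvl-false {a} Ma = least-none (λ i → Tᵢ i a) (suc n) λ j _ → underived j
    where
    underived : ∀ j → Tᵢ j a ≡ false
    underived j with Tᵢ j a in h
    ... | false = refl
    ... | true  = true≢false (T⇒M {j} h) Ma

  lvl-≤ : ∀ {a} k → Tᵢ k a ≡ true → lvl a ≤ k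
  lvl-≤ {a} k h = ℕP.≮⇒≥ λ k<lvl → true≢false h (least-below (λ i → Tᵢ i a) (suc n) k k<lvl)

  lvl-pos : ∀ {a} → a ∈ S → 1 ≤ lvl a
  lvl-pos {a} a∈S = least-pos (λ i → Tᵢ i a) n (I-false a∈S)

  τ₀ : Var → ℤ
  τ₀ z     = + 0
  τ₀ (x a) = + lvl a

  -- each dep_{a,b} and gap_{a,b} is decided by the formula defining it
  N₀ : BAtom → Bool
  N₀ (atm a)   = M a
  N₀ (dep a b) = M b ∧ does (τ₀ (x b) - τ₀ (x a) ℤ.≤? ℤ.- + 1)
  N₀ (gap a b) = M b ∧ does (τ₀ (x b) - τ₀ (x a) ℤ.≤? ℤ.- + 2)
  N₀ (app r)   = false

  -- ⟨N₀, τ₀⟩ already fixes every atom occurring in the body of r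
  Nₘ : BAtom → Bool
  Nₘ (app r) = eval ⟨ N₀ , τ₀ ⟩ (body (head r) r)
  Nₘ β       = N₀ β

  dlModel : DLInterp
  dlModel = ⟨ Nₘ , τ₀ ⟩

  body-eval : ∀ a r → eval dlModel (body a r) ≡ eval ⟨ N₀ , τ₀ ⟩ (body a r)
  body-eval a r = cong₂ _∧_ (⋀-map-cong _ (posS r) λ _ → refl)
                    (cong₂ _∧_ (⋀-map-cong _ (posN r) λ _ → refl) (⋀-map-cong _ (neg r) λ _ → refl))

  lvl-spec : ∀ {a} → a ∈ S → τ₀ (x a) - τ₀ z ≡ + lvl a
  lvl-spec {a} _ = cong +_ (ℕP.+-identityʳ (lvl a))

  open Clauses P S dlModel
  open LevelReading dlModel S lvl lvl-spec

  guarded⇔ : ∀ {a b} k β → a ∈ S → b ∈ S → Nₘ β ≡ eval dlModel (atom (atm b) ∧' geq (x a) (x b) k) →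
             (Nₘ β ≡ true) ⇔ (M b ≡ true × lvl b + k ≤ lvl a)
  guarded⇔ {a} {b} k β a∈S b∈S def =
    ⊨guarded⇔ k β a∈S b∈S (⊨⇔⁺ {dlModel} {atom β} {atom (atm b) ∧' geq (x a) (x b) k} def)

  fire-at : ∀ {a r} k → a ∈ S → r ∈ Def a P → BodyHolds a r →
            (∀ {b} → b ∈ pos r → b ∈ S → lvl b ≤ k) → Tᵢ (suc k) a ≡ true
  fire-at {a} {r} k a∈S r∈Def (deps , posN-true , negs-false) below =
    T-suc⁺ {k} (r∈PS , proj₂ (∈-Def⁻ P r∈Def) , negs-false , All.tabulate derived)
    where
    r∈PS : r ∈ Module P S
    r∈PS = Def⊆Module P S a∈S r∈Def
    derived : ∀ {b} → b ∈ pos r → Tᵢ k b ≡ true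
    derived {b} b∈pos with b ∈? S
    ... | yes b∈S = T-mono b (below b∈pos b∈S) (proj₁ (proj₁ (lvl-minimal b∈S Mb)))
      where
      Mb : M b ≡ true
      Mb = proj₁ (Equivalence.to (guarded⇔ 1 (dep a b) a∈S b∈S refl) (deps b∈pos b∈S))
    ... | no b∉S = trans (T-∉S k b∉S)
                     (trans (sym (proj₁ (proj₂ stable) b (pos∈At P S r∈PS b∈pos) b∉S)) (posN-true b∈pos b∉S))

  app≡body : ∀ {a r} → r ∈ Def a P → Nₘ (app r) ≡ eval dlModel (body a r)
  app≡body {r = r} r∈Def with ∈-Def⁻ P r∈Def
  ... | _ , refl = sym (body-eval (head r) r)

  supported : ∀ {a} → a ∈ S → Supported a
  supported {a} a∈S = mk⇔ applied derives
    where
    applied : M a ≡ true → Any (λ r → Nₘ (app r) ≡ true) (Def a P)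
    applied Ma with lvl a in lvl-eq | proj₁ (proj₁ (lvl-minimal a∈S Ma))
    ... | zero  | derived = true≢false derived (I-false a∈S)
    ... | suc k | derived with T-suc⁻ k a derived
    ... | inj₁ Ia = true≢false Ia (I-false a∈S)
    ... | inj₂ (r , r∈PS , refl , negs , poss) =
      lose (Module⊆Def P S r∈PS) (trans (app≡body (Module⊆Def P S r∈PS)) (⊨body⁺ {a} {r} body-r))
      where
      body-r : BodyHolds a r
      body-r = (λ {b} b∈pos b∈S → Equivalence.from (guarded⇔ 1 (dep a b) a∈S b∈S refl)
                  (T⇒M {k} (All.lookup poss b∈pos) ,
                   subst₂ _≤_ (ℕP.+-comm 1 (lvl b)) (sym lvl-eq) (s≤s (lvl-≤ k (All.lookup poss b∈pos)))))
             , (λ b∈pos _ → T⇒M {k} (All.lookup poss b∈pos))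
             , negs
    derives : Any (λ r → Nₘ (app r) ≡ true) (Def a P) → M a ≡ true
    derives apps with find apps
    ... | r , r∈Def , app-r = T⇒M {suc (suc n)}
      (fire-at (suc n) a∈S r∈Def (⊨body⁻ {a} {r} (trans (sym (app≡body r∈Def)) app-r))
               (λ {b} _ _ → least-≤ (λ i → Tᵢ i b) (suc n)))

  tight : ∀ {a r} → a ∈ S → r ∈ Def a P → Nₘ (app r) ≡ true → Tight a (posS r)
  tight {a} {r} a∈S r∈Def app-r = tight-for (posS r) refl
    where
    body-r : BodyHolds a r
    body-r = ⊨body⁻ {a} {r} (trans (sym (app≡body r∈Def)) app-r)
    tight-for : ∀ bs → posS r ≡ bs → Tight a bs
    tight-for [] posS≡[] = Equivalence.from (⊨leq-z 1 a∈S)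
      (lvl-≤ 1 (fire-at 0 a∈S r∈Def body-r λ b∈pos b∈S →
        case subst (_ ∈_) posS≡[] (∈-posS⁺ {r = r} b∈pos b∈S) of λ ()))
    tight-for bs@(c ∷ _) posS≡bs with All.all? (λ b → Nₘ (gap a b) Data.Bool.≟ true) bs
    ... | no not-all = Any.map ¬-not (AllP.¬All⇒Any¬ (λ b → Nₘ (gap a b) Data.Bool.≟ true) bs not-all)
    ... | yes all-gaps = ⊥-elim (ℕP.<-irrefl refl (subst (_≤ suc k) lvl-eq (lvl-≤ (suc k) derived-earlier)))
      where
      gap-bound : ∀ {b} → b ∈ bs → lvl b + 2 ≤ lvl a
      gap-bound {b} b∈bs = proj₂ (Equivalence.to
        (guarded⇔ 2 (gap a b) a∈S (proj₂ (∈-posS⁻ {r = r} (subst (_ ∈_) (sym posS≡bs) b∈bs))) refl)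
        (All.lookup all-gaps b∈bs))
      lvl≡2+k : ∃ λ k → lvl a ≡ suc (suc k)
      lvl≡2+k = let (k , eq) = ℕP.m≤n⇒∃[o]m+o≡n (ℕP.≤-trans (ℕP.m≤n+m 2 (lvl c)) (gap-bound (here refl)))
                in  k , sym eq
      k : ℕ
      k = proj₁ lvl≡2+k
      lvl-eq : lvl a ≡ suc (suc k)
      lvl-eq = proj₂ lvl≡2+k
      derived-earlier : Tᵢ (suc k) a ≡ true
      derived-earlier = fire-at k a∈S r∈Def body-r λ {b} b∈pos b∈S →
        ℕP.≤-pred (ℕP.≤-pred (subst₂ _≤_ (ℕP.+-comm (lvl b) 2) lvl-eq
          (gap-bound (subst (_ ∈_) posS≡bs (∈-posS⁺ {r = r} b∈pos b∈S)))))

  dlModel⊨TOC : dlModel ⊨TOC[ P , S ]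
  dlModel⊨TOC = ⊨TOC⁺ sat-i sat-ii sat-iii
    where
    sat-i : Sat-i
    sat-i {a} a∈S =
      ∧-true⁺ (Equivalence.from (⊨geq-z 1 a∈S) (lvl-pos a∈S))
              (Equivalence.from (⊨leq-z (suc n) a∈S) (least-≤ (λ i → Tᵢ i a) (suc n)))
      ∷ ⊨⇒⁺ {dlModel} {¬' atom (atm a)} {geq (x a) z (suc n)}
          (λ ¬Ma → Equivalence.from (⊨geq-z (suc n) a∈S)
                     (ℕP.≤-reflexive (sym (lvl-false (not-true⁻ ¬Ma)))))
      ∷ []
    sat-ii : Sat-ii
    sat-ii {a} {b} _ _ _ = ⊨⇔⁺ {dlModel} {atom (dep a b)} {atom (atm b) ∧' geq (x a) (x b) 1} refl
                         ∷ ⊨⇔⁺ {dlModel} {atom (gap a b)} {atom (atm b) ∧' geq (x a) (x b) 2} refl ∷ []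
    sat-iii : Sat-iii
    sat-iii a∈S = ⊨TOC-iii⁺ (supported a∈S) (λ r∈Def → app≡body r∈Def , tight a∈S r∈Def)

  model-agrees : ∀ a → M a ≡ modelOf P S dlModel a
  model-agrees a with M a in Ma
  ... | false = refl
  ... | true rewrite ∈ᵇ-true⁺ (proj₁ stable a Ma) = refl

  rank-agrees : ∀ a k → a ∈ S → M a ≡ true → IsLevelRank P S M I a k → τ dlModel (x a) ≡ + k
  rank-agrees a k a∈S Ma (_ , derived , underived) =
    cong +_ (Minimal-unique (proj₁ (lvl-minimal a∈S Ma)) (derived , underived′))
    where
    underived′ : ∀ j → j < k → Tᵢ j a ≡ false
    underived′ zero    _   = I-false a∈S
    underived′ (suc j) j<k = underived (suc j) (s≤s z≤n) j<k

  false-rank : ∀ a → a ∈ S → M a ≡ false → τ dlModel (x a) ≡ + suc n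
  false-rank a _ Ma = cong +_ (lvl-false Ma)

theorem1 : (P : Program) (S : List ℕ) → Unique S → IsSCC P S →
    ((M I : Interp) → IsInput P S I → IsStableModel P S M I →
      Σ DLInterp λ J →
        J ⊨TOC[ P , S ] ×
        τ J z ≡ + 0 ×
        (∀ a → M a ≡ modelOf P S J a) ×
        (∀ a n → a ∈ S → M a ≡ true → IsLevelRank P S M I a n → τ J (x a) ≡ + n) ×
        (∀ a → a ∈ S → M a ≡ false → τ J (x a) ≡ + suc (length S)))
    ×
    ((J : DLInterp) → J ⊨TOC[ P , S ] →
      IsInput P S (inputOf P S J) ×
      IsStableModel P S (modelOf P S J) (inputOf P S J) ×
      (∀ a → a ∈ S → modelOf P S J a ≡ true →
        ∃ λ n → τ J (x a) - τ J z ≡ + n × IsLevelRank P S (modelOf P S J) (inputOf P S J) a n))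
theorem1 P S _ _ =
  (λ M I input stable → let open ToDL P S M I input stable in
     dlModel , dlModel⊨TOC , refl , model-agrees , rank-agrees , false-rank) ,
  (λ J J⊨TOC → let open FromDL P S J J⊨TOC in
     isInput , isStable , λ a a∈S Ma → lev a , lev-spec a∈S , isLevelRank a∈S Ma)
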